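{- Let $(\mathbf{s},\mathbf{t})\neq(\mathbf{1},\mathbf{1})$ and let $p$ be a prime. Then: (i) $\varpi(\mathbf{s},\mathbf{t})=\prod_{q \text{ prime},\ (\mathbf{s}^{[q]},\mathbf{t}^{[q]})\neq(\mathbf{1},\mathbf{1})}\varpi(\mathbf{s}^{[q]},\mathbf{t}^{[q]})$; (ii) $\varpi(\mathbf{s},\mathbf{t})=0$ if some coordinate of $\mathbf{s}$ or $\mathbf{t}$ is divisible by $p^2$; (iii) $\varpi(\mathbf{s},\mathbf{t})=0$ if some coordinate of $\mathbf{s}$ or $\mathbf{t}$ is divisible by $p$ but there exists $0\le j\le n$ with $s_j^{[p]}=t_{j,1}^{[p]}=\dots=t_{j,m_j-1}^{[p]}=1$; (iv) $\varpi(\mathbf{s}^{[p]},\mathbf{t}^{[p]})\ll 1$, with implied constant depending only on $n$ and $m_0,\dots,m_n$.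
   Context: Let $n\ge1$ and integers $m_0,\dots,m_n\ge2$. Vectors are $\mathbf{s}\in\mathbb{N}^{n+1}$ and $\mathbf{t}=(t_{j,r})_{0\le j\le n,1\le r\le m_j-1}$ with positive integer entries; $\mathbf{1}$ denotes an all-ones vector. For a prime $p$, $\mathbf{s}^{[p]}$ has coordinates $p^{\mathrm{val}_p(s_j)}$ and $\mathbf{t}^{[p]}$ has coordinates $p^{\mathrm{val}_p(t_{j,r})}$. Let $\mathcal{G}$ be the set of $\mathbf{g}\in\mathbb{N}^{n+1}$ with $1\le g_j\le m_j-1$. For a finite set $\mathcal{R}$ of triples $(\mathbf{g};p;I)$ with $\mathbf{g}\in\mathcal{G}$, $p$ prime, $I\subseteq\{0,\dots,n\}$ (possibly empty), let $\mathcal{R}(p)$ be the triples in $\mathcal{R}$ with prime $p$, $I(\mathcal{R}(p))=\bigcup_{(\mathbf{g};p;I)\in\mathcal{R}(p)}I$ and $J(\mathbf{g};\mathcal{R}(p))=\bigcup_{(\mathbf{g}';p;I)\in\mathcal{R}(p),\ \mathbf{g}'=\mathbf{g}}(\{0,\dots,n\}\setminus I)$ (empty unions empty, empty products $1$). Define $\mathbf{a}(\mathcal{R})$ by $a_j=\prod_{p:\ j\in I(\mathcal{R}(p))}p$ and $\mathbf{b}(\mathcal{R})$ by $b_{j,r}=\prod p$ over primes $p$ with $j\in J(\mathbf{g};\mathcal{R}(p))$ for some $\mathbf{g}\in\mathcal{G}$ with $g_j=r$. Finally $$\varpi(\mathbf{s},\mathbf{t})=\sum_{k=1}^\infty(-1)^k\#\{\mathcal{R}:\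 \#\mathcal{R}=k,\ (\mathbf{s},\mathbf{t})=(\mathbf{a}(\mathcal{R}),\mathbf{b}(\mathcal{R}))\}.$$ -}

module Defs where

open import Data.Nat using (ℕ; zero; suc; _+_; _*_; _∸_; _^_; _≤_; _<_)
open import Data.Nat.Divisibility using (_∣?_)
open import Data.Nat.DivMod using (_/_)
open import Data.Nat.Primality using (prime?)
open import Data.Integer as ℤ using (ℤ; +_)
open import Data.Fin using (Fin; zero; suc; toℕ; _≟_)
open import Data.Bool using (Bool; true; false; _∧_; _∨_; not; if_then_else_)
open import Data.List using (List; []; _∷_; map; concatMap; filter; foldr; upTo; length)
open import Data.Bool.ListAction using (and; or)
open import Data.List.Base using (allFin)
open import Data.Product using (_×_; _,_; proj₁; proj₂)
open import Data.Vec using (Vec; []; _∷_; lookup)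
open import Relation.Binary.PropositionalEquality using (_≡_)
open import Relation.Nullary.Decidable using (⌊_⌋; does)

-- Data of the paper.  Indices j ∈ {0,…,n} are  Fin (suc n);
-- the index r ∈ {1,…,m_j − 1} is represented by  r' : Fin (m j ∸ 1)
-- with r = toℕ r' + 1.

SVec : (n : ℕ) → Set
SVec n = Fin (suc n) → ℕ

TVec : (n : ℕ) (m : Fin (suc n) → ℕ) → Set
TVec n m = (j : Fin (suc n)) → Fin (m j ∸ 1) → ℕ

-- g ∈ 𝒢 : g_j ∈ {1,…,m_j − 1}, represented as above
GVec : (n : ℕ) (m : Fin (suc n) → ℕ) → Set
GVec n m = (j : Fin (suc n)) → Fin (m j ∸ 1)

Sub : ℕ → Set
Sub n = Vec Bool (suc n)

Triple : (n : ℕ) (m : Fin (suc n) → ℕ) → Set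
Triple n m = GVec n m × ℕ × Sub n

allFuns : (k : ℕ) (B : Fin k → ℕ) → List ((i : Fin k) → Fin (B i))
allFuns zero    B = (λ ()) ∷ []
allFuns (suc k) B =
  concatMap (λ x → map (λ f → λ { zero → x ; (suc i) → f i })
                       (allFuns k (λ i → B (suc i))))
            (allFin (B zero))

allG : (n : ℕ) (m : Fin (suc n) → ℕ) → List (GVec n m)
allG n m = allFuns (suc n) (λ j → m j ∸ 1)

allVecBool : (k : ℕ) → List (Vec Bool k)
allVecBool zero    = [] ∷ []
allVecBool (suc k) = concatMap (λ b → map (b ∷_) (allVecBool k)) (true ∷ false ∷ [])

allSub : (n : ℕ) → List (Sub n)
allSub n = allVecBool (suc n)

primesUpTo : ℕ → List ℕ
primesUpTo B = filter prime? (upTo (suc B))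

-- all sublists (= all subsets, when the list has no repetitions)
sublists : {A : Set} → List A → List (List A)
sublists []       = [] ∷ []
sublists (x ∷ xs) = let r = sublists xs in map (x ∷_) r Data.List.++ r

prodℕ : List ℕ → ℕ
prodℕ = foldr _*_ 1

sumℤ : List ℤ → ℤ
sumℤ = foldr ℤ._+_ (+ 0)

prodℤ : List ℤ → ℤ
prodℤ = foldr ℤ._*_ (+ 1)

allFinB : (k : ℕ) → (Fin k → Bool) → Bool
allFinB k P = and (map P (allFin k))

anyFinB : (k : ℕ) → (Fin k → Bool) → Bool
anyFinB k P = or (map P (allFin k))

anyL : {A : Set} → (A → Bool) → List A → Bool
anyL P xs = or (map P xs)

eqG : {n : ℕ} {m : Fin (suc n) → ℕ} → GVec n m → GVec n m → Bool
eqG {n} g g' = allFinB (suc n) (λ j → does (g j ≟ g' j))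

-- a(ℛ) and b(ℛ).  The products over "all primes p" are taken over a
-- list P of primes containing every prime occurring in ℛ (primes not
-- occurring in ℛ contribute the factor 1, since ℛ(p) = ∅).

module _ {n : ℕ} {m : Fin (suc n) → ℕ} where

  primeOf : Triple n m → ℕ
  primeOf (_ , p , _) = p

  inI : List (Triple n m) → ℕ → Fin (suc n) → Bool
  inI R p j = anyL (λ { (g , q , I) → does (q Data.Nat.≟ p) ∧ lookup I j }) R

  -- j ∈ J(g ; ℛ(p)) = ⋃_{(g';p;I) ∈ ℛ(p), g' = g} ({0..n} ∖ I)
  inJ : List (Triple n m) → ℕ → GVec n m → Fin (suc n) → Bool
  inJ R p g j = anyL (λ { (g' , q , I) → does (q Data.Nat.≟ p) ∧ eqG {n} {m} g' g ∧ not (lookup I j) }) R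

  aR : List ℕ → List (Triple n m) → SVec n
  aR P R j = prodℕ (map (λ p → if inI R p j then p else 1) P)

  bR : List ℕ → List (Triple n m) → TVec n m
  bR P R j r = prodℕ (map (λ p → if anyL (λ g → does (g j ≟ r) ∧ inJ R p g j) (allG n m)
                                   then p else 1) P)

module _ {n : ℕ} {m : Fin (suc n) → ℕ} where

  eqST : SVec n → TVec n m → SVec n → TVec n m → Bool
  eqST s t s' t' = allFinB (suc n) (λ j → does (s j Data.Nat.≟ s' j))
                 ∧ allFinB (suc n) (λ j → allFinB (m j ∸ 1) (λ r → does (t j r Data.Nat.≟ t' j r)))

  -- product of all coordinates of (s,t); every prime occurring in an ℛ with
  -- (a(ℛ),b(ℛ)) = (s,t) divides some coordinate, hence is ≤ bound s t
  -- (for positive coordinates).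
  bound : SVec n → TVec n m → ℕ
  bound s t = prodℕ (map s (allFin (suc n)))
            * prodℕ (map (λ j → prodℕ (map (t j) (allFin (m j ∸ 1)))) (allFin (suc n)))

  candidates : ℕ → List (Triple n m)
  candidates B = concatMap (λ g → concatMap (λ p → map (λ I → (g , p , I)) (allSub n))
                                            (primesUpTo B))
                           (allG n m)

  sign : ℕ → ℤ
  sign zero    = + 1
  sign (suc k) = ℤ.- sign k

  -- ϖ(s,t) = Σ_{k ≥ 1} (-1)^k #{ℛ : #ℛ = k, (s,t) = (a(ℛ),b(ℛ))}
  --        = Σ_{ℛ ≠ ∅, (a(ℛ),b(ℛ)) = (s,t)} (-1)^{#ℛ}
  varpi : SVec n → TVec n m → ℤ
  varpi s t = sumℤ (map term (sublists (candidates B)))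
    where
    B = bound s t
    P = primesUpTo B
    term : List (Triple n m) → ℤ
    term []        = + 0
    term R@(_ ∷ _) = if eqST s t (aR {n} {m} P R) (bR {n} {m} P R) then sign (length R) else + 0

valAux : ℕ → ℕ → ℕ → ℕ
valAux zero       p x = 0
valAux (suc fuel) zero x = 0
valAux (suc fuel) (suc p) zero = 0
valAux (suc fuel) (suc p) (suc x) =
  if does (suc p ∣? suc x) then suc (valAux fuel (suc p) (suc x / suc p)) else 0

-- val_p(x) for p ≥ 2, x ≥ 1 (fuel x suffices since p^val ≤ x)
val : ℕ → ℕ → ℕ
val p x = valAux x p x

ppart : ℕ → ℕ → ℕ
ppart p x = p ^ val p x

module _ {n : ℕ} {m : Fin (suc n) → ℕ} where

  sLoc : ℕ → SVec n → SVec n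
  sLoc p s j = ppart p (s j)

  tLoc : ℕ → TVec n m → TVec n m
  tLoc p t j r = ppart p (t j r)

  IsOnes : SVec n → TVec n m → Set
  IsOnes s t = (∀ j → s j ≡ 1)
             × (∀ j r → t j r ≡ 1)

  isOnesB : SVec n → TVec n m → Bool
  isOnesB s t = eqST {n} {m} s t (λ _ → 1) (λ _ _ → 1)

  -- ∏_{q prime, (s^[q],t^[q]) ≠ (1,1)} ϖ(s^[q],t^[q]); all such q divide a
  -- coordinate, hence q ≤ bound s t.
  localProduct : SVec n → TVec n m → ℤ
  localProduct s t =
    prodℤ (map (λ q → if isOnesB (sLoc q s) (tLoc q t) then + 1 else varpi {n} {m} (sLoc q s) (tLoc q t))
               (primesUpTo (bound {n} {m} s t)))

-- Every coordinate of a(ℛ) and b(ℛ) is a product of distinct primes, and its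
-- p-part only depends on ℛ(p).  So (a(ℛ),b(ℛ)) = (s,t) holds iff (a(ℛ(p)),b(ℛ(p))) = (s^[p],t^[p]) for
-- every p; as ℛ ↦ (ℛ(p))_p is a bijection onto tuples of sets and (-1)^#ℛ = ∏_p (-1)^#ℛ(p), the sum
-- factorises into the local sums ϖ(s^[p],t^[p]), which is (i).  Squarefreeness gives (ii).  A triple
-- (g;p;I) ∈ ℛ puts p into a_j(ℛ) or into b_{j,g_j}(ℛ) for every j, and p occurs in ℛ as soon as it
-- divides a coordinate; this gives (iii).  For p-power vectors only triples with prime p can occur, so
-- ϖ(s^[p],t^[p]) is a signed sum over the subsets of the #𝒢·2^(n+1) such triples, which gives (iv).

{-# OPTIONS --safe #-}
module Submission where

open import Defs
open import Data.Nat as ℕ using (ℕ; zero; suc; _∸_; _≤_; _<_; z≤n; s≤s; NonZero)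
import Data.Nat.Properties as ℕ
open import Data.Nat.ListAction using (product)
open import Data.Nat.ListAction.Properties using (∈⇒∣product; product≢0)
open import Data.Nat.Divisibility
  using (_∣_; _∣?_; divides; divides-refl; ∣-trans; ∣1⇒≡1; ∣⇒≤; m∣m*n; n∣m*n; m*n∣⇒m∣)
open import Data.Nat.DivMod using (m*n/n≡m)
open import Data.Nat.Primality
  using (Prime; prime?; euclidsLemma; prime⇒irreducible; prime⇒nonTrivial; ¬prime[1]; productOfPrimes≥1)
open import Data.Nat.Primality.Factorisation using (factorise; factorisationHasAllPrimeFactors)
open import Algebra.Properties.CommutativeSemigroup ℕ.*-commutativeSemigroup using (interchange)
open import Data.Integer as ℤ using (ℤ; +_; -1ℤ; ∣_∣)
import Data.Integer.Properties as ℤ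
open import Data.Fin as Fin using (Fin; _≟_)
open import Data.Vec using (lookup)
open import Data.Bool using (Bool; true; false; T; _∧_; _∨_; not; if_then_else_)
open import Data.Bool.Properties using (T-∧; T-≡; if-cong)
open import Data.Bool.ListAction using (and; or)
open import Data.List using (List; []; _∷_; [_]; map; filter; filterᵇ; _++_; length; concatMap; upTo; allFin)
open import Data.List.Properties
  using (map-++; map-∘; map-cong; map-cong-local; filter-accept; filter-reject; filter-++; filter-all; filter-none;
         concatMap-cong; ++-identityʳ; length-++; length-map)
open import Data.List.Relation.Unary.All as All using (All; []; _∷_)
import Data.List.Relation.Unary.All.Properties as All
open import Data.List.Relation.Unary.Any as Any using (Any; here; there)
open import Data.List.Relation.Unary.Any.Properties using (any⁺; any⁻)
open import Data.List.Membership.Propositional using (_∈_; _∉_; find)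
open import Data.List.Membership.Propositional.Properties
  using (∈-filter⁺; ∈-filter⁻; ∈-upTo⁺; ∈-map⁺; ∈-allFin)
open import Data.List.Membership.DecPropositional ℕ._≟_ using (_∈?_)
open import Data.List.Relation.Unary.Unique.Propositional using (Unique)
import Data.List.Relation.Unary.Unique.Propositional.Properties as Unique
open import Data.List.Relation.Unary.AllPairs using ([]; _∷_)
open import Data.Product using (_×_; _,_; proj₁; proj₂; ∃-syntax)
open import Data.Sum using (_⊎_; inj₁; inj₂)
open import Data.Unit using (⊤; tt)
open import Function using (id; _∘_; _⇔_; mk⇔; Equivalence; case_of_)
open import Relation.Nullary using (¬_; Dec; yes; no; does; contradiction)
open import Relation.Nullary.Decidable using (T?; dec-true; dec-false)
open import Relation.Unary using (Decidable)
open import Relation.Binary.PropositionalEquality hiding ([_])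

-- Sums over sublists, and their factorisation along a colouring

-- Integer addition and multiplication are opened in this block only; later on _+_ and _*_ are on ℕ.
module _ where

  open import Data.Integer using (_+_; _*_)

  sumℤ-++ : (xs ys : List ℤ) → sumℤ (xs ++ ys) ≡ sumℤ xs + sumℤ ys
  sumℤ-++ []       ys = sym (ℤ.+-identityˡ _)
  sumℤ-++ (x ∷ xs) ys = trans (cong (λ z → x + z) (sumℤ-++ xs ys)) (sym (ℤ.+-assoc x _ _))

  sumSublists : {A : Set} → List A → (List A → ℤ) → ℤ
  sumSublists L f = sumℤ (map f (sublists L))

  module _ {A : Set} where

    sumSublists-∷ : (x : A) (xs : List A) (f : List A → ℤ) →
      sumSublists (x ∷ xs) f ≡ sumSublists xs (λ R → f (x ∷ R)) + sumSublists xs f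
    sumSublists-∷ x xs f = begin
      sumℤ (map f (map (x ∷_) r ++ r))             ≡⟨ cong sumℤ (map-++ f (map (x ∷_) r) r) ⟩
      sumℤ (map f (map (x ∷_) r) ++ map f r)       ≡⟨ sumℤ-++ (map f (map (x ∷_) r)) (map f r) ⟩
      sumℤ (map f (map (x ∷_) r)) + sumℤ (map f r) ≡⟨ cong (λ z → sumℤ z + sumℤ (map f r)) (map-∘ r) ⟨
      sumSublists xs (λ R → f (x ∷ R)) + sumSublists xs f ∎
      where open ≡-Reasoning
            r = sublists xs

    module _ (Q : A → Set) where

      sumSublists-cong : (L : List A) {f g : List A → ℤ} → All Q L →
        (∀ R → All Q R → f R ≡ g R) → sumSublists L f ≡ sumSublists L g
      sumSublists-cong []       _          f≡g = cong (_+ + 0) (f≡g [] [])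
      sumSublists-cong (x ∷ xs) (qx ∷ qxs) f≡g = begin
        sumSublists (x ∷ xs) _                   ≡⟨ sumSublists-∷ x xs _ ⟩
        sumSublists xs _ + sumSublists xs _      ≡⟨ cong₂ _+_ (sumSublists-cong xs qxs (λ R qR → f≡g (x ∷ R) (qx ∷ qR)))
                                                              (sumSublists-cong xs qxs f≡g) ⟩
        sumSublists xs _ + sumSublists xs _      ≡⟨ sumSublists-∷ x xs _ ⟨
        sumSublists (x ∷ xs) _                   ∎
        where open ≡-Reasoning

      sumSublists-zero : (L : List A) {f : List A → ℤ} → All Q L →
        (∀ R → All Q R → f R ≡ + 0) → sumSublists L f ≡ + 0
      sumSublists-zero []       _          f≡0 = cong (_+ + 0) (f≡0 [] [])
      sumSublists-zero (x ∷ xs) (qx ∷ qxs) f≡0 = begin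
        sumSublists (x ∷ xs) _              ≡⟨ sumSublists-∷ x xs _ ⟩
        sumSublists xs _ + sumSublists xs _ ≡⟨ cong₂ _+_ (sumSublists-zero xs qxs (λ R qR → f≡0 (x ∷ R) (qx ∷ qR)))
                                                         (sumSublists-zero xs qxs f≡0) ⟩
        + 0                                 ∎
        where open ≡-Reasoning

      sumSublists-only[] : (L : List A) {f : List A → ℤ} → All Q L →
        (∀ x R → All Q (x ∷ R) → f (x ∷ R) ≡ + 0) → sumSublists L f ≡ f []
      sumSublists-only[] []       _          _   = ℤ.+-identityʳ _
      sumSublists-only[] (x ∷ xs) {f} (qx ∷ qxs) f≡0 = begin
        sumSublists (x ∷ xs) f              ≡⟨ sumSublists-∷ x xs f ⟩
        sumSublists xs _ + sumSublists xs f ≡⟨ cong₂ _+_ (sumSublists-zero xs qxs (λ R qR → f≡0 x R (qx ∷ qR)))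
                                                         (sumSublists-only[] xs qxs f≡0) ⟩
        + 0 + f []                          ≡⟨ ℤ.+-identityˡ _ ⟩
        f []                                ∎
        where open ≡-Reasoning

      sumSublists-filter : {P : A → Set} (P? : Decidable P) (L : List A) {f : List A → ℤ} → All Q L →
        (∀ R → All Q R → f R ≢ + 0 → All P R) → sumSublists L f ≡ sumSublists (filter P? L) f
      sumSublists-filter P? []       _          _       = refl
      sumSublists-filter P? (x ∷ xs) {f} (qx ∷ qxs) support with P? x
      ... | yes px = begin
        sumSublists (x ∷ xs) f              ≡⟨ sumSublists-∷ x xs f ⟩
        sumSublists xs _ + sumSublists xs f ≡⟨ cong₂ _+_ (sumSublists-filter P? xs qxs tail-support)
                                                         (sumSublists-filter P? xs qxs support) ⟩
        sumSublists (filter P? xs) _ + sumSublists (filter P? xs) f ≡⟨ sumSublists-∷ x (filter P? xs) f ⟨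
        sumSublists (x ∷ filter P? xs) f    ∎
        where
        open ≡-Reasoning
        tail-support : ∀ R → All Q R → f (x ∷ R) ≢ + 0 → All _ R
        tail-support R qR f≢0 = All.tail (support (x ∷ R) (qx ∷ qR) f≢0)
      ... | no ¬px = begin
        sumSublists (x ∷ xs) f              ≡⟨ sumSublists-∷ x xs f ⟩
        sumSublists xs _ + sumSublists xs f ≡⟨ cong₂ _+_ (sumSublists-zero xs qxs vanishes)
                                                         (sumSublists-filter P? xs qxs support) ⟩
        + 0 + sumSublists (filter P? xs) f  ≡⟨ ℤ.+-identityˡ _ ⟩
        sumSublists (filter P? xs) f        ∎
        where
        open ≡-Reasoning
        vanishes : ∀ R → All Q R → f (x ∷ R) ≡ + 0
        vanishes R qR with f (x ∷ R) ℤ.≟ + 0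
        ... | yes f≡0 = f≡0
        ... | no  f≢0 = contradiction (All.head (support (x ∷ R) (qx ∷ qR) f≢0)) ¬px

    ∣sumSublists∣≤2^length : (L : List A) (f : List A → ℤ) → (∀ R → ∣ f R ∣ ≤ 1) →
      ∣ sumSublists L f ∣ ≤ 2 ℕ.^ length L
    ∣sumSublists∣≤2^length []       f ∣f∣≤1 =
      subst (_≤ 1) (cong ∣_∣ (sym (ℤ.+-identityʳ (f [])))) (∣f∣≤1 [])
    ∣sumSublists∣≤2^length (x ∷ xs) f ∣f∣≤1 = begin
      ∣ sumSublists (x ∷ xs) f ∣                 ≡⟨ cong ∣_∣ (sumSublists-∷ x xs f) ⟩
      ∣ Σ₁ + Σ₂ ∣                                ≤⟨ ℤ.∣i+j∣≤∣i∣+∣j∣ Σ₁ Σ₂ ⟩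
      ∣ Σ₁ ∣ ℕ.+ ∣ Σ₂ ∣                          ≤⟨ ℕ.+-mono-≤ (∣sumSublists∣≤2^length xs _ (λ R → ∣f∣≤1 (x ∷ R)))
                                                             (∣sumSublists∣≤2^length xs f ∣f∣≤1) ⟩
      2 ℕ.^ length xs ℕ.+ 2 ℕ.^ length xs       ≡⟨ cong (2 ℕ.^ length xs ℕ.+_) (ℕ.+-identityʳ _) ⟨
      2 ℕ.^ length (x ∷ xs)                     ∎
      where
      open ℕ.≤-Reasoning
      Σ₁ = sumSublists xs (λ R → f (x ∷ R))
      Σ₂ = sumSublists xs f

  AgreeOff : ℕ → List ℕ → (ℕ → ℤ) → (ℕ → ℤ) → Set
  AgreeOff c P G F = All (λ q → q ≢ c → G q ≡ F q) P

  prodℤ-linearAt : {P : List ℕ} {c : ℕ} → Unique P → c ∈ P → (F : ℕ → ℤ) →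
    ∃[ K ] (∀ G → AgreeOff c P G F → prodℤ (map G P) ≡ G c * K)
  prodℤ-linearAt {c ∷ P} (c∉P ∷ _) (here refl) F = prodℤ (map F P) , λ where
    G (_ ∷ G≈F) → cong (G c *_) (cong prodℤ (map-cong-local
                     (All.zipWith (λ (q≢c→G≡F , c≢q) → q≢c→G≡F (c≢q ∘ sym)) (G≈F , c∉P))))
  prodℤ-linearAt {p ∷ P} {c} (p∉P ∷ uP) (there c∈P) F =
    let K , linear = prodℤ-linearAt uP c∈P F in
    F p * K , λ where
      G (p≢c→G≡F ∷ G≈F) → begin
        G p * prodℤ (map G P) ≡⟨ cong₂ _*_ (p≢c→G≡F p≢c) (linear G G≈F) ⟩
        F p * (G c * K)       ≡⟨ ℤ.*-assoc (F p) (G c) K ⟨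
        F p * G c * K         ≡⟨ cong (_* K) (ℤ.*-comm (F p) (G c)) ⟩
        G c * F p * K         ≡⟨ ℤ.*-assoc (G c) (F p) K ⟩
        G c * (F p * K)       ∎
    where
    open ≡-Reasoning
    p≢c : p ≢ c
    p≢c p≡c = All.lookup p∉P c∈P p≡c

  agreeOff-refl : (c : ℕ) (P : List ℕ) (F : ℕ → ℤ) → AgreeOff c P F F
  agreeOff-refl c P F = All.universal (λ _ _ → refl) P

  prodℤ-additiveAt : {P : List ℕ} {c : ℕ} {H F₁ F₂ : ℕ → ℤ} → Unique P → c ∈ P →
    AgreeOff c P H F₁ → AgreeOff c P F₂ F₁ → H c ≡ F₁ c + F₂ c →
    prodℤ (map H P) ≡ prodℤ (map F₁ P) + prodℤ (map F₂ P)
  prodℤ-additiveAt {P} {c} {H} {F₁} {F₂} uP c∈P H≈F₁ F₂≈F₁ Hc≡ = begin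
    prodℤ (map H P)                      ≡⟨ linear H H≈F₁ ⟩
    H c * K                              ≡⟨ cong (_* K) Hc≡ ⟩
    (F₁ c + F₂ c) * K                    ≡⟨ ℤ.*-distribʳ-+ K (F₁ c) (F₂ c) ⟩
    F₁ c * K + F₂ c * K                  ≡⟨ cong₂ _+_ (linear F₁ (agreeOff-refl c P F₁)) (linear F₂ F₂≈F₁) ⟨
    prodℤ (map F₁ P) + prodℤ (map F₂ P)  ∎
    where
    open ≡-Reasoning
    K = proj₁ (prodℤ-linearAt uP c∈P F₁)
    linear = proj₂ (prodℤ-linearAt uP c∈P F₁)

  prodℤ-scaleAt : {P : List ℕ} {c : ℕ} {H F : ℕ → ℤ} (k : ℤ) → Unique P → c ∈ P →
    AgreeOff c P H F → H c ≡ k * F c → prodℤ (map H P) ≡ k * prodℤ (map F P)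
  prodℤ-scaleAt {P} {c} {H} {F} k uP c∈P H≈F Hc≡ = begin
    prodℤ (map H P)     ≡⟨ linear H H≈F ⟩
    H c * K             ≡⟨ cong (_* K) Hc≡ ⟩
    k * F c * K         ≡⟨ ℤ.*-assoc k (F c) K ⟩
    k * (F c * K)       ≡⟨ cong (k *_) (linear F (agreeOff-refl c P F)) ⟨
    k * prodℤ (map F P) ∎
    where
    open ≡-Reasoning
    K = proj₁ (prodℤ-linearAt uP c∈P F)
    linear = proj₂ (prodℤ-linearAt uP c∈P F)

  module _ {A : Set} (colour : A → ℕ) where

    fibre : ℕ → List A → List A
    fibre q = filter (λ x → colour x ℕ.≟ q)

    fibre-∷-same : ∀ {q x} xs → colour x ≡ q → fibre q (x ∷ xs) ≡ x ∷ fibre q xs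
    fibre-∷-same xs = filter-accept (λ x → colour x ℕ.≟ _)

    fibre-∷-other : ∀ {q x} xs → colour x ≢ q → fibre q (x ∷ xs) ≡ fibre q xs
    fibre-∷-other xs = filter-reject (λ x → colour x ℕ.≟ _)

    fibre-concatMap : (F : ℕ → List A) → (∀ p → All (λ x → colour x ≡ p) (F p)) → ∀ q P →
      fibre q (concatMap F P) ≡ concatMap F (filter (ℕ._≟ q) P)
    fibre-concatMap F F≡ q []      = refl
    fibre-concatMap F F≡ q (p ∷ P) with p ℕ.≟ q
    ... | yes refl = begin
      fibre p (F p ++ concatMap F P)             ≡⟨ filter-++ (λ x → colour x ℕ.≟ p) (F p) _ ⟩
      fibre p (F p) ++ fibre p (concatMap F P)   ≡⟨ cong₂ _++_ (filter-all (λ x → colour x ℕ.≟ p) (F≡ p))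
                                                               (fibre-concatMap F F≡ p P) ⟩
      F p ++ concatMap F (filter (ℕ._≟ p) P)     ≡⟨ cong (concatMap F) (filter-accept (ℕ._≟ p) refl) ⟨
      concatMap F (filter (ℕ._≟ p) (p ∷ P))      ∎
      where open ≡-Reasoning
    ... | no p≢q = begin
      fibre q (F p ++ concatMap F P)             ≡⟨ filter-++ (λ x → colour x ℕ.≟ q) (F p) _ ⟩
      fibre q (F p) ++ fibre q (concatMap F P)   ≡⟨ cong₂ _++_ (filter-none (λ x → colour x ℕ.≟ q) (All.map colour≢q (F≡ p)))
                                                               (fibre-concatMap F F≡ q P) ⟩
      concatMap F (filter (ℕ._≟ q) P)            ≡⟨ cong (concatMap F) (filter-reject (ℕ._≟ q) p≢q) ⟨
      concatMap F (filter (ℕ._≟ q) (p ∷ P))      ∎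
      where
      open ≡-Reasoning
      colour≢q : ∀ {x} → colour x ≡ p → colour x ≢ q
      colour≢q x≡p x≡q = p≢q (trans (sym x≡p) x≡q)

    ColouredBy : List ℕ → List A → Set
    ColouredBy P = All (λ x → colour x ∈ P)

    -- Adding x to L changes only the factor at colour x, and the sum is additive in that factor.
    sumSublists-factorise : {P : List ℕ} → Unique P → (L : List A) → ColouredBy P L → (G : ℕ → List A → ℤ) →
      sumSublists L (λ R → prodℤ (map (λ q → G q (fibre q R)) P))
        ≡ prodℤ (map (λ q → sumSublists (fibre q L) (G q)) P)
    sumSublists-factorise {P} uP [] _ G =
      trans (ℤ.+-identityʳ _) (cong prodℤ (map-cong-local (All.universal (λ q → sym (ℤ.+-identityʳ (G q []))) P)))
    sumSublists-factorise {P} uP (x ∷ xs) (x∈P ∷ xs⊆P) G = begin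
      sumSublists (x ∷ xs) F
        ≡⟨ sumSublists-∷ x xs F ⟩
      sumSublists xs (λ R → F (x ∷ R)) + sumSublists xs F
        ≡⟨ cong (_+ sumSublists xs F) (sumSublists-cong (λ _ → ⊤) xs (All.universal _ xs) (λ R _ → split-head R)) ⟩
      sumSublists xs (λ R → prodℤ (map (λ q → G q (fibre q [ x ] ++ fibre q R)) P)) + sumSublists xs F
        ≡⟨ cong₂ _+_ (sumSublists-factorise uP xs xs⊆P (λ q R → G q (fibre q [ x ] ++ R)))
                     (sumSublists-factorise uP xs xs⊆P G) ⟩
      prodℤ (map F₁ P) + prodℤ (map F₂ P)
        ≡⟨ prodℤ-additiveAt uP x∈P (All.universal H≈F₁ P) (All.universal F₂≈F₁ P) Hc≡ ⟨
      prodℤ (map H P) ∎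
      where
      open ≡-Reasoning
      F : List A → ℤ
      F R = prodℤ (map (λ q → G q (fibre q R)) P)
      split-head : ∀ R → F (x ∷ R) ≡ prodℤ (map (λ q → G q (fibre q [ x ] ++ fibre q R)) P)
      split-head R = cong prodℤ (map-cong-local (All.universal (λ q → cong (G q) (filter-++ (λ y → colour y ℕ.≟ q) [ x ] R)) P))
      F₁ F₂ H : ℕ → ℤ
      F₁ q = sumSublists (fibre q xs) (λ R → G q (fibre q [ x ] ++ R))
      F₂ q = sumSublists (fibre q xs) (G q)
      H q  = sumSublists (fibre q (x ∷ xs)) (G q)
      F₂≈F₁ : ∀ q → q ≢ colour x → F₂ q ≡ F₁ q
      F₂≈F₁ q q≢c = cong (λ Z → sumSublists (fibre q xs) (λ R → G q (Z ++ R))) (sym (fibre-∷-other [] (q≢c ∘ sym)))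
      H≈F₁ : ∀ q → q ≢ colour x → H q ≡ F₁ q
      H≈F₁ q q≢c = trans (cong (λ Z → sumSublists Z (G q)) (fibre-∷-other xs (q≢c ∘ sym))) (F₂≈F₁ q q≢c)
      Hc≡ : H (colour x) ≡ F₁ (colour x) + F₂ (colour x)
      Hc≡ = begin
        H c                                      ≡⟨ cong (λ Z → sumSublists Z (G c)) (fibre-∷-same xs refl) ⟩
        sumSublists (x ∷ fibre c xs) (G c)       ≡⟨ sumSublists-∷ x (fibre c xs) (G c) ⟩
        sumSublists (fibre c xs) (λ R → G c (x ∷ R)) + F₂ c
                                                 ≡⟨ cong (λ Z → sumSublists (fibre c xs) (λ R → G c (Z ++ R)) + F₂ c)
                                                         (fibre-∷-same [] refl) ⟨
        F₁ c + F₂ c                              ∎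
        where c = colour x

    -1^length-factorise : {P : List ℕ} → Unique P → (R : List A) → ColouredBy P R →
      -1ℤ ℤ.^ length R ≡ prodℤ (map (λ q → -1ℤ ℤ.^ length (fibre q R)) P)
    -1^length-factorise {P} uP [] _ = sym (prodℤ-ones P)
      where
      prodℤ-ones : (P : List ℕ) → prodℤ (map (λ _ → + 1) P) ≡ + 1
      prodℤ-ones []      = refl
      prodℤ-ones (_ ∷ P) = trans (ℤ.*-identityˡ _) (prodℤ-ones P)
    -1^length-factorise {P} uP (x ∷ R) (x∈P ∷ R⊆P) = begin
      -1ℤ * -1ℤ ℤ.^ length R ≡⟨ cong (-1ℤ *_) (-1^length-factorise uP R R⊆P) ⟩
      -1ℤ * prodℤ (map F P)   ≡⟨ prodℤ-scaleAt -1ℤ uP x∈P (All.universal H≈F P)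
                                   (cong (λ Z → -1ℤ ℤ.^ length Z) (fibre-∷-same R refl)) ⟨
      prodℤ (map H P)        ∎
      where
      open ≡-Reasoning
      F H : ℕ → ℤ
      F q = -1ℤ ℤ.^ length (fibre q R)
      H q = -1ℤ ℤ.^ length (fibre q (x ∷ R))
      H≈F : ∀ q → q ≢ colour x → H q ≡ F q
      H≈F q q≢c = cong (λ Z → -1ℤ ℤ.^ length Z) (fibre-∷-other R (q≢c ∘ sym))

-- The p-adic valuation

open import Data.Nat using (_+_; _*_; _^_)

prime⇒2≤ : ∀ {p} → Prime p → 2 ≤ p
prime⇒2≤ {p} pp = ℕ.nonTrivial⇒n>1 p {{prime⇒nonTrivial pp}}

prime⇒1≤ : ∀ {p} → Prime p → 1 ≤ p
prime⇒1≤ pp = ℕ.<⇒≤ (prime⇒2≤ pp)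

1≤p^e : ∀ {p} e → 2 ≤ p → 1 ≤ p ^ e
1≤p^e {p@(suc _)} e _ = ℕ.m^n>0 p e

1≤* : ∀ {a b} → 1 ≤ a → 1 ≤ b → 1 ≤ a * b
1≤* = ℕ.*-mono-≤

∤⇒1≤ : ∀ {p u} → ¬ p ∣ u → 1 ≤ u
∤⇒1≤ {u = zero}  p∤0 = contradiction (divides 0 refl) p∤0
∤⇒1≤ {u = suc _} _   = s≤s z≤n

-- The existence and uniqueness of the decomposition x = p ^ valAux fuel p x * u are both proved by
-- induction on the fuel, so that no fuel-independence lemma for valAux is needed.
valAux-step : ∀ fuel {p y} → 2 ≤ p → 1 ≤ y → valAux (suc fuel) p (y * p) ≡ suc (valAux fuel p y)
valAux-step fuel {p} {y} (s≤s (s≤s _)) (s≤s _) =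
  trans (if-cong (dec-true (p ∣? y * p) (n∣m*n y))) (cong (λ z → suc (valAux fuel p z)) (m*n/n≡m y p))

valAux-stop : ∀ fuel {p x} → 2 ≤ p → ¬ p ∣ x → valAux (suc fuel) p x ≡ 0
valAux-stop fuel {p} {zero}  (s≤s (s≤s _)) p∤0 = contradiction (divides 0 refl) p∤0
valAux-stop fuel {p} {suc x} (s≤s (s≤s _)) p∤x = if-cong (dec-false (p ∣? suc x) p∤x)

p^[1+e]*u≡p^e*u*p : ∀ p e u → p ^ suc e * u ≡ (p ^ e * u) * p
p^[1+e]*u≡p^e*u*p p e u = trans (ℕ.*-assoc p (p ^ e) u) (ℕ.*-comm p (p ^ e * u))

valAux-decompose : ∀ fuel {p x} → 2 ≤ p → 1 ≤ x → x ≤ fuel →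
  ∃[ u ] (x ≡ p ^ valAux fuel p x * u × ¬ p ∣ u)
valAux-decompose zero    _   1≤x x≤0 = contradiction (ℕ.≤-trans 1≤x x≤0) λ ()
valAux-decompose (suc f) {p} {x} 2≤p 1≤x x≤f+1 with p ∣? x
... | no p∤x = x , sym (trans (cong (λ e → p ^ e * x) (valAux-stop f 2≤p p∤x)) (ℕ.*-identityˡ x)) , p∤x
... | yes (divides-refl y) =
  let u , y≡ , p∤u = valAux-decompose f 2≤p 1≤y (ℕ.≤-pred (ℕ.<-≤-trans y<y*p x≤f+1))
  in u , (begin
    y * p                             ≡⟨ cong (_* p) y≡ ⟩
    (p ^ valAux f p y * u) * p        ≡⟨ p^[1+e]*u≡p^e*u*p p (valAux f p y) u ⟨
    p ^ suc (valAux f p y) * u        ≡⟨ cong (λ e → p ^ e * u) (valAux-step f 2≤p 1≤y) ⟨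
    p ^ valAux (suc f) p (y * p) * u  ∎) , p∤u
  where
  open ≡-Reasoning
  1≤y : 1 ≤ y
  1≤y = ℕ.n≢0⇒n>0 λ { refl → contradiction 1≤x λ () }
  y<y*p : y < y * p
  y<y*p = ℕ.m<m*n y p {{ℕ.>-nonZero 1≤y}} 2≤p

valAux-unique : ∀ fuel {p u} e → 2 ≤ p → ¬ p ∣ u → p ^ e * u ≤ fuel → valAux fuel p (p ^ e * u) ≡ e
valAux-unique zero    e 2≤p p∤u x≤0 =
  contradiction (ℕ.≤-trans (1≤* (1≤p^e e 2≤p) (∤⇒1≤ p∤u)) x≤0) λ ()
valAux-unique (suc f) {p} {u} zero 2≤p p∤u _ =
  trans (cong (valAux (suc f) p) (ℕ.*-identityˡ u)) (valAux-stop f 2≤p p∤u)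
valAux-unique (suc f) {p} {u} (suc e) 2≤p p∤u x≤f+1 = begin
  valAux (suc f) p (p ^ suc e * u)    ≡⟨ cong (valAux (suc f) p) (p^[1+e]*u≡p^e*u*p p e u) ⟩
  valAux (suc f) p ((p ^ e * u) * p)  ≡⟨ valAux-step f 2≤p 1≤p^e*u ⟩
  suc (valAux f p (p ^ e * u))        ≡⟨ cong suc (valAux-unique f e 2≤p p∤u p^e*u≤f) ⟩
  suc e                               ∎
  where
  open ≡-Reasoning
  1≤p^e*u = 1≤* (1≤p^e e 2≤p) (∤⇒1≤ p∤u)
  p^e*u≤f : p ^ e * u ≤ f
  p^e*u≤f = ℕ.≤-pred (ℕ.<-≤-trans (subst (p ^ e * u <_) (sym (p^[1+e]*u≡p^e*u*p p e u))
                                   (ℕ.m<m*n (p ^ e * u) p {{ℕ.>-nonZero 1≤p^e*u}} 2≤p)) x≤f+1)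

ppart-decompose : ∀ {p x} → 2 ≤ p → 1 ≤ x → ∃[ u ] (x ≡ ppart p x * u × ¬ p ∣ u)
ppart-decompose 2≤p 1≤x = valAux-decompose _ 2≤p 1≤x ℕ.≤-refl

val[p^e*u]≡e : ∀ {p u} e → 2 ≤ p → ¬ p ∣ u → val p (p ^ e * u) ≡ e
val[p^e*u]≡e e 2≤p p∤u = valAux-unique _ e 2≤p p∤u ℕ.≤-refl

∤⇒val≡0 : ∀ {p x} → 2 ≤ p → ¬ p ∣ x → val p x ≡ 0
∤⇒val≡0 {p} {x} 2≤p p∤x = trans (cong (val p) (sym (ℕ.*-identityˡ x))) (val[p^e*u]≡e 0 2≤p p∤x)

val[p^e]≡e : ∀ {p} e → 2 ≤ p → val p (p ^ e) ≡ e
val[p^e]≡e {p} e 2≤p = trans (cong (val p) (sym (ℕ.*-identityʳ (p ^ e)))) (val[p^e*u]≡e e 2≤p p∤1)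
  where
  p∤1 : ¬ p ∣ 1
  p∤1 p∣1 = contradiction (subst (2 ≤_) (∣1⇒≡1 p∣1) 2≤p) λ { (s≤s ()) }

val-* : ∀ {p x y} → Prime p → 1 ≤ x → 1 ≤ y → val p (x * y) ≡ val p x + val p y
val-* {p} {x} {y} pp 1≤x 1≤y with ppart-decompose (prime⇒2≤ pp) 1≤x | ppart-decompose (prime⇒2≤ pp) 1≤y
... | u , x≡ , p∤u | v , y≡ , p∤v = begin
  val p (x * y)                      ≡⟨ cong₂ (λ a b → val p (a * b)) x≡ y≡ ⟩
  val p ((p ^ a * u) * (p ^ b * v))  ≡⟨ cong (val p) (interchange (p ^ a) u (p ^ b) v) ⟩
  val p ((p ^ a * p ^ b) * (u * v))  ≡⟨ cong (λ z → val p (z * (u * v))) (ℕ.^-distribˡ-+-* p a b) ⟨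
  val p (p ^ (a + b) * (u * v))      ≡⟨ val[p^e*u]≡e (a + b) (prime⇒2≤ pp) p∤uv ⟩
  a + b                              ∎
  where
  open ≡-Reasoning
  a = val p x
  b = val p y
  p∤uv : ¬ p ∣ u * v
  p∤uv p∣uv with euclidsLemma u v pp p∣uv
  ... | inj₁ p∣u = p∤u p∣u
  ... | inj₂ p∣v = p∤v p∣v

p^k∣⇒k≤val : ∀ {p x} k → Prime p → 1 ≤ x → p ^ k ∣ x → k ≤ val p x
p^k∣⇒k≤val {p} k pp 1≤x (divides-refl y) = begin
  k                      ≤⟨ ℕ.m≤n+m k (val p y) ⟩
  val p y + k            ≡⟨ cong (λ z → val p y + z) (val[p^e]≡e k (prime⇒2≤ pp)) ⟨
  val p y + val p (p ^ k) ≡⟨ val-* pp 1≤y (1≤p^e k (prime⇒2≤ pp)) ⟨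
  val p (y * p ^ k)      ∎
  where
  open ℕ.≤-Reasoning
  1≤y : 1 ≤ y
  1≤y = ℕ.n≢0⇒n>0 λ { refl → contradiction 1≤x λ () }

ppart≡1⇒∤ : ∀ {p x} → Prime p → 1 ≤ x → ppart p x ≡ 1 → ¬ p ∣ x
ppart≡1⇒∤ {p} {x} pp 1≤x p^v≡1 p∣x with ℕ.m^n≡1⇒n≡0∨m≡1 p (val p x) p^v≡1
... | inj₁ v≡0 = contradiction (subst (1 ≤_) v≡0 (p^k∣⇒k≤val 1 pp 1≤x p¹∣x)) λ ()
  where p¹∣x = subst (_∣ x) (sym (ℕ.*-identityʳ p)) p∣x
... | inj₂ p≡1 = ¬prime[1] (subst Prime p≡1 pp)

prime∣prime⇒≡ : ∀ {r q} → Prime r → Prime q → r ∣ q → r ≡ q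
prime∣prime⇒≡ pr pq r∣q with prime⇒irreducible pq r∣q
... | inj₁ r≡1 = contradiction (subst Prime r≡1 pr) ¬prime[1]
... | inj₂ r≡q = r≡q

prime∣p^e⇒≡ : ∀ {r q} e → Prime r → Prime q → r ∣ q ^ e → r ≡ q
prime∣p^e⇒≡ zero    pr pq r∣1 = contradiction (subst Prime (∣1⇒≡1 r∣1) pr) ¬prime[1]
prime∣p^e⇒≡ (suc e) pr pq r∣q^[1+e] with euclidsLemma _ _ pr r∣q^[1+e]
... | inj₁ r∣q   = prime∣prime⇒≡ pr pq r∣q
... | inj₂ r∣q^e = prime∣p^e⇒≡ e pr pq r∣q^e

val[q^e*w]≡val : ∀ {r q w} e → Prime r → Prime q → r ≢ q → 1 ≤ w → val r (q ^ e * w) ≡ val r w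
val[q^e*w]≡val {r} {q} {w} e pr pq r≢q 1≤w = begin
  val r (q ^ e * w)         ≡⟨ val-* pr (1≤p^e e (prime⇒2≤ pq)) 1≤w ⟩
  val r (q ^ e) + val r w   ≡⟨ cong (_+ val r w) (∤⇒val≡0 (prime⇒2≤ pr) (r≢q ∘ prime∣p^e⇒≡ e pr pq)) ⟩
  val r w                   ∎
  where open ≡-Reasoning

x≡∏ppart : ∀ {P} → Unique P → All Prime P → ∀ {x} → 1 ≤ x → (∀ {r} → Prime r → r ∣ x → r ∈ P) →
  x ≡ product (map (λ q → ppart q x) P)
x≡∏ppart {[]} _ _ {x} 1≤x factors∈[] with factorise x {{ℕ.>-nonZero 1≤x}}
... | record { factors = []     ; isFactorisation = x≡1 } = x≡1
... | record { factors = r ∷ rs ; isFactorisation = x≡r*rs ; factorsPrime = pr ∷ _ } =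
  contradiction (factors∈[] pr (divides (product rs) (trans x≡r*rs (ℕ.*-comm r _)))) λ ()
x≡∏ppart {p ∷ P} (p∉P ∷ uP) (pp ∷ pP) {x} 1≤x factors∈ with ppart-decompose (prime⇒2≤ pp) 1≤x
... | w , x≡ , p∤w = begin
  x                                              ≡⟨ x≡ ⟩
  ppart p x * w                                  ≡⟨ cong (ppart p x *_) (x≡∏ppart uP pP (∤⇒1≤ p∤w) factors∈P) ⟩
  ppart p x * product (map (λ q → ppart q w) P)  ≡⟨ cong (λ z → ppart p x * product z) (map-cong-local
                                                      (All.zipWith ppart-cofactor (p∉P , pP))) ⟩
  ppart p x * product (map (λ q → ppart q x) P)  ∎
  where
  open ≡-Reasoning
  factors∈P : ∀ {r} → Prime r → r ∣ w → r ∈ P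
  factors∈P pr r∣w with factors∈ pr (∣-trans r∣w (divides (ppart p x) x≡))
  ... | here refl = contradiction r∣w p∤w
  ... | there r∈P = r∈P
  ppart-cofactor : ∀ {q} → p ≢ q × Prime q → ppart q w ≡ ppart q x
  ppart-cofactor {q} (p≢q , pq) =
    cong (q ^_) (sym (trans (cong (val q) x≡) (val[q^e*w]≡val (val p x) pq pp (p≢q ∘ sym) (∤⇒1≤ p∤w))))

≡-byPrimeParts : ∀ {P} → Unique P → All Prime P → ∀ {x y} → 1 ≤ x → 1 ≤ y →
  (∀ {r} → Prime r → r ∣ x → r ∈ P) → (∀ {r} → Prime r → r ∣ y → r ∈ P) →
  All (λ q → ppart q x ≡ ppart q y) P → x ≡ y
≡-byPrimeParts {P} uP pP {x} {y} 1≤x 1≤y factorsˣ factorsʸ parts≡ = begin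
  x                                   ≡⟨ x≡∏ppart uP pP 1≤x factorsˣ ⟩
  product (map (λ q → ppart q x) P)   ≡⟨ cong product (map-cong-local parts≡) ⟩
  product (map (λ q → ppart q y) P)   ≡⟨ x≡∏ppart uP pP 1≤y factorsʸ ⟨
  y                                   ∎
  where open ≡-Reasoning

-- Products of distinct primes

primeProduct : (ℕ → Bool) → List ℕ → ℕ
primeProduct c P = prodℕ (map (λ p → if c p then p else 1) P)

primeProduct≡product-filterᵇ : (c : ℕ → Bool) (P : List ℕ) → primeProduct c P ≡ product (filterᵇ c P)
primeProduct≡product-filterᵇ c []      = refl
primeProduct≡product-filterᵇ c (p ∷ P) with c p
... | true  = cong (p *_) (primeProduct≡product-filterᵇ c P)
... | false = trans (ℕ.*-identityˡ _) (primeProduct≡product-filterᵇ c P)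

val-product-∈ : ∀ {Q q} → Unique Q → All Prime Q → q ∈ Q → val q (product Q) ≡ 1
val-product-∈ {q ∷ Q} (q∉Q ∷ _) (pq ∷ pQ) (here refl) = begin
  val q (q * product Q)              ≡⟨ val-* pq (prime⇒1≤ pq) (productOfPrimes≥1 pQ) ⟩
  val q q + val q (product Q)        ≡⟨ cong₂ _+_ val[q]≡1 (∤⇒val≡0 (prime⇒2≤ pq) q∤Q) ⟩
  1                                  ∎
  where
  open ≡-Reasoning
  val[q]≡1 = trans (cong (val q) (sym (ℕ.*-identityʳ q))) (val[p^e]≡e 1 (prime⇒2≤ pq))
  q∤Q : ¬ q ∣ product Q
  q∤Q q∣Q = All.lookup q∉Q (factorisationHasAllPrimeFactors pq q∣Q pQ) refl
val-product-∈ {p ∷ Q} {q} (p∉Q ∷ uQ) (pp ∷ pQ) (there q∈Q) = begin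
  val q (p * product Q)              ≡⟨ cong (λ z → val q (z * product Q)) (ℕ.*-identityʳ p) ⟨
  val q (p ^ 1 * product Q)          ≡⟨ val[q^e*w]≡val 1 (All.lookup pQ q∈Q) pp q≢p (productOfPrimes≥1 pQ) ⟩
  val q (product Q)                  ≡⟨ val-product-∈ uQ pQ q∈Q ⟩
  1                                  ∎
  where
  open ≡-Reasoning
  q≢p : q ≢ p
  q≢p q≡p = All.lookup p∉Q q∈Q (sym q≡p)

∈⇒∣primeProduct : ∀ {P q} (c : ℕ → Bool) → q ∈ P → T (c q) → q ∣ primeProduct c P
∈⇒∣primeProduct {P} c q∈P cq =
  subst (_ ∣_) (sym (primeProduct≡product-filterᵇ c P)) (∈⇒∣product (∈-filter⁺ (T? ∘ c) q∈P cq))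

primeProduct-none : ∀ {P} (c : ℕ → Bool) → (∀ r → ¬ T (c r)) → primeProduct c P ≡ 1
primeProduct-none {P} c ¬c =
  trans (primeProduct≡product-filterᵇ c P) (cong product (filter-none (T? ∘ c) (All.universal ¬c P)))

module _ {P : List ℕ} (uP : Unique P) (pP : All Prime P) (c : ℕ → Bool) where

  private
    Q = filterᵇ c P

    uQ : Unique Q
    uQ = Unique.filter⁺ (T? ∘ c) uP

    pQ : All Prime Q
    pQ = All.filter⁺ (T? ∘ c) pP

    X≡∏Q : primeProduct c P ≡ product Q
    X≡∏Q = primeProduct≡product-filterᵇ c P

  1≤primeProduct : 1 ≤ primeProduct c P
  1≤primeProduct = subst (1 ≤_) (sym X≡∏Q) (productOfPrimes≥1 pQ)

  prime∣primeProduct⇒ : ∀ {r} → Prime r → r ∣ primeProduct c P → r ∈ P × T (c r)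
  prime∣primeProduct⇒ pr r∣X = ∈-filter⁻ (T? ∘ c) (factorisationHasAllPrimeFactors pr (subst (_ ∣_) X≡∏Q r∣X) pQ)

  val-primeProduct : ∀ {q} → q ∈ P → T (c q) → val q (primeProduct c P) ≡ 1
  val-primeProduct q∈P cq = trans (cong (val _) X≡∏Q) (val-product-∈ uQ pQ (∈-filter⁺ (T? ∘ c) q∈P cq))

  ppart-primeProduct : ∀ {q} → q ∈ P → ppart q (primeProduct c P) ≡ (if c q then q else 1)
  ppart-primeProduct {q} q∈P with c q in cq≡
  ... | true  = trans (cong (q ^_) (val-primeProduct q∈P (subst T (sym cq≡) tt))) (ℕ.*-identityʳ q)
  ... | false = cong (q ^_) (∤⇒val≡0 (prime⇒2≤ pq) λ q∣X → subst T cq≡ (proj₂ (prime∣primeProduct⇒ pq q∣X)))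
    where pq = All.lookup pP q∈P

  primeProduct-squarefree : ∀ {p} → Prime p → ¬ p ^ 2 ∣ primeProduct c P
  primeProduct-squarefree {p} pp p²∣X =
    let p∈P , cp = prime∣primeProduct⇒ pp (m*n∣⇒m∣ p (p * 1) p²∣X)
    in contradiction (subst (2 ≤_) (val-primeProduct p∈P cp) (p^k∣⇒k≤val 2 pp 1≤primeProduct p²∣X)) λ { (s≤s ()) }

  ≡primeProduct-byPrimeParts : ∀ {x} → 1 ≤ x → (∀ {r} → Prime r → r ∣ x → r ∈ P) →
    (∀ {q} → q ∈ P → ppart q x ≡ ppart q (primeProduct c P)) → x ≡ primeProduct c P
  ≡primeProduct-byPrimeParts 1≤x factors parts≡ = ≡-byPrimeParts uP pP 1≤x 1≤primeProduct factors
    (λ pr r∣X → proj₁ (prime∣primeProduct⇒ pr r∣X)) (All.tabulate parts≡)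

  primeProduct-single : ∀ {q} → q ∈ P → (∀ {r} → T (c r) → r ≡ q) →
    primeProduct c P ≡ (if c q then q else 1)
  primeProduct-single {q} q∈P only-q = begin
    primeProduct c P                      ≡⟨ x≡∏ppart ([] ∷ []) (All.lookup pP q∈P ∷ []) 1≤primeProduct factor≡q ⟩
    ppart q (primeProduct c P) * 1        ≡⟨ ℕ.*-identityʳ _ ⟩
    ppart q (primeProduct c P)            ≡⟨ ppart-primeProduct q∈P ⟩
    (if c q then q else 1)                ∎
    where
    open ≡-Reasoning
    factor≡q : ∀ {r} → Prime r → r ∣ primeProduct c P → r ∈ [ q ]
    factor≡q pr r∣X = here (only-q (proj₂ (prime∣primeProduct⇒ pr r∣X)))

-- The sum ϖ(s,t)

T-does⇒ : ∀ {A : Set} (d : Dec A) → T (does d) → A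
T-does⇒ (yes a) _ = a

⇒T-does : ∀ {A : Set} (d : Dec A) → A → T (does d)
⇒T-does d a = subst T (sym (dec-true d a)) tt

T-injective : ∀ {b c} → (T b → T c) → (T c → T b) → b ≡ c
T-injective {false} {false} _ _ = refl
T-injective {false} {true}  _ c⇒b = contradiction (c⇒b tt) λ ()
T-injective {true}  {false} b⇒c _ = contradiction (b⇒c tt) λ ()
T-injective {true}  {true}  _ _ = refl

allFinB⇔ : ∀ {k} (P : Fin k → Bool) → T (allFinB k P) ⇔ (∀ i → T (P i))
allFinB⇔ {k} P = mk⇔ (All.tabulate⁻ ∘ All.all⁺ P (allFin k)) (All.all⁻ P ∘ All.tabulate⁺)

anyL-filter : {A : Set} {P : A → Set} (P? : Decidable P) (f : A → Bool) (xs : List A) →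
  (∀ x → ¬ P x → f x ≡ false) → anyL f (filter P? xs) ≡ anyL f xs
anyL-filter P? f []       _     = refl
anyL-filter P? f (x ∷ xs) ¬P⇒ff with P? x
... | yes _  = cong (f x ∨_) (anyL-filter P? f xs ¬P⇒ff)
... | no ¬px = trans (anyL-filter P? f xs ¬P⇒ff) (cong (_∨ anyL f xs) (sym (¬P⇒ff x ¬px)))

filter-concatMap : {A B : Set} {P : B → Set} (P? : Decidable P) (f : A → List B) (xs : List A) →
  filter P? (concatMap f xs) ≡ concatMap (filter P? ∘ f) xs
filter-concatMap P? f []       = refl
filter-concatMap P? f (x ∷ xs) =
  trans (filter-++ P? (f x) (concatMap f xs)) (cong (filter P? (f x) ++_) (filter-concatMap P? f xs))

filter-≟-unique : ∀ {P q} → Unique P → q ∈ P → filter (ℕ._≟ q) P ≡ [ q ]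
filter-≟-unique {q ∷ P} (q∉P ∷ _) (here refl) =
  trans (filter-accept (ℕ._≟ q) refl) (cong (q ∷_) (filter-none (ℕ._≟ q) (All.map (_∘ sym) q∉P)))
filter-≟-unique {p ∷ P} (p∉P ∷ uP) (there q∈P) =
  trans (filter-reject (ℕ._≟ _) (All.lookup p∉P q∈P)) (filter-≟-unique uP q∈P)

product-allFin≢0 : ∀ {k} (f : Fin k → ℕ) → (∀ i → NonZero (f i)) → NonZero (product (map f (allFin k)))
product-allFin≢0 f f≢0 = product≢0 (All.map⁺ {f = f} (All.tabulate⁺ {f = id} f≢0))

prodℤ-if : (b : ℕ → Bool) (X : ℕ → ℤ) (P : List ℕ) →
  prodℤ (map (λ q → if b q then X q else + 0) P) ≡ (if and (map b P) then prodℤ (map X P) else + 0)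
prodℤ-if b X []      = refl
prodℤ-if b X (p ∷ P) with b p
... | false = refl
... | true rewrite prodℤ-if b X P with and (map b P)
...   | true  = refl
...   | false = ℤ.*-zeroʳ (X p)

primesUpTo-unique : ∀ B → Unique (primesUpTo B)
primesUpTo-unique B = Unique.filter⁺ prime? (Unique.upTo⁺ (suc B))

primesUpTo-prime : ∀ B → All Prime (primesUpTo B)
primesUpTo-prime B = All.all-filter prime? (upTo (suc B))

∈-primesUpTo : ∀ {B r} → Prime r → r ≤ B → r ∈ primesUpTo B
∈-primesUpTo pr r≤B = ∈-filter⁺ prime? (∈-upTo⁺ (s≤s r≤B)) pr

module Varpi (n : ℕ) (m : Fin (suc n) → ℕ) where

  Trip : Set
  Trip = Triple n m

  𝐚 : List ℕ → List Trip → SVec n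
  𝐚 = aR {n} {m}

  𝐛 : List ℕ → List Trip → TVec n m
  𝐛 = bR {n} {m}

  -- By definition, 𝐚 P R j = primeProduct (λ p → inI R p j) P
  -- and 𝐛 P R j r = primeProduct (λ p → inB R p j r) P.
  inB : List Trip → ℕ → (j : Fin (suc n)) → Fin (m j ∸ 1) → Bool
  inB R p j r = anyL (λ g → does (g j ≟ r) ∧ inJ {n} {m} R p g j) (allG n m)

  SameST : SVec n → TVec n m → SVec n → TVec n m → Set
  SameST s t s′ t′ = (∀ j → s j ≡ s′ j) × (∀ j r → t j r ≡ t′ j r)

  eqST⇔ : ∀ {s t s′ t′} → T (eqST {n} {m} s t s′ t′) ⇔ SameST s t s′ t′
  eqST⇔ {s} {t} {s′} {t′} = mk⇔
    (λ st → let s≡ , t≡ = Equivalence.to (T-∧ {allFinB _ Ps}) st in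
      (λ j → T-does⇒ (s j ℕ.≟ s′ j) (to (allFinB⇔ Ps) s≡ j)) ,
      (λ j r → T-does⇒ (t j r ℕ.≟ t′ j r) (to (allFinB⇔ (Pt j)) (to (allFinB⇔ Pt′) t≡ j) r)))
    (λ (s≡ , t≡) → Equivalence.from (T-∧ {allFinB _ Ps})
      ( from (allFinB⇔ Ps) (λ j → ⇒T-does (s j ℕ.≟ s′ j) (s≡ j))
      , from (allFinB⇔ Pt′) (λ j → from (allFinB⇔ (Pt j)) (λ r → ⇒T-does (t j r ℕ.≟ t′ j r) (t≡ j r)))))
    where
    open Equivalence
    Ps : Fin (suc n) → Bool
    Ps j = does (s j ℕ.≟ s′ j)
    Pt : (j : Fin (suc n)) → Fin (m j ∸ 1) → Bool
    Pt j r = does (t j r ℕ.≟ t′ j r)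
    Pt′ : Fin (suc n) → Bool
    Pt′ j = allFinB (m j ∸ 1) (Pt j)

  Occurs : ℕ → List Trip → Set
  Occurs p = Any (λ x → primeOf {n} {m} x ≡ p)

  primeOf≡ : ∀ {p} x {b} → T (does (primeOf {n} {m} x ℕ.≟ p) ∧ b) → primeOf {n} {m} x ≡ p
  primeOf≡ {p} x = T-does⇒ (primeOf {n} {m} x ℕ.≟ p) ∘ proj₁ ∘ Equivalence.to T-∧

  inI⇒Occurs : ∀ {R p j} → T (inI {n} {m} R p j) → Occurs p R
  inI⇒Occurs {R} = Any.map (λ {x} → primeOf≡ x) ∘ any⁻ _ R

  inJ⇒Occurs : ∀ {R p g j} → T (inJ {n} {m} R p g j) → Occurs p R
  inJ⇒Occurs {R} = Any.map (λ {x} → primeOf≡ x) ∘ any⁻ _ R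

  inB⇒Occurs : ∀ {R p j r} → T (inB R p j r) → Occurs p R
  inB⇒Occurs {R} {p} {j} {r} inB-true with Any.satisfied (any⁻ _ (allG n m) inB-true)
  ... | g , gj≡r∧inJ = inJ⇒Occurs {g = g} (proj₂ (Equivalence.to (T-∧ {does (g j ≟ r)}) gj≡r∧inJ))

  Occurs-single : ∀ {R p q} → All (λ x → primeOf {n} {m} x ≡ q) R → Occurs p R → p ≡ q
  Occurs-single all≡q occ = let x≡q , x≡p = All.lookupAny all≡q occ in trans (sym x≡p) x≡q

  matching⇒∣ : ∀ {P R s t g q I} → SameST s t (𝐚 P R) (𝐛 P R) → (g , q , I) ∈ R → g ∈ allG n m → q ∈ P →
    ∀ j → (q ∣ s j) ⊎ (q ∣ t j (g j))
  matching⇒∣ {P} {R} {s} {t} {g} {q} {I} (s≡ , t≡) x∈R g∈G q∈P j with lookup I j in Ij≡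
  ... | true  = inj₁ (subst (q ∣_) (sym (s≡ j)) (∈⇒∣primeProduct _ q∈P (any⁺ _ (Any.map
                  (λ { refl → Equivalence.from T-∧ (q≡q , subst T (sym Ij≡) tt) }) x∈R))))
    where q≡q = ⇒T-does (q ℕ.≟ q) refl
  ... | false = inj₂ (subst (q ∣_) (sym (t≡ j (g j))) (∈⇒∣primeProduct _ q∈P (any⁺ _ (Any.map
                  (λ { refl → Equivalence.from T-∧ (⇒T-does (g j ≟ g j) refl , inJ-true) }) g∈G))))
    where
    eqG-refl : T (eqG {n} {m} g g)
    eqG-refl = Equivalence.from (allFinB⇔ (λ j → does (g j ≟ g j))) (λ j → ⇒T-does (g j ≟ g j) refl)
    inJ-true : T (inJ {n} {m} R q g j)
    inJ-true = any⁺ _ (Any.map (λ { refl → Equivalence.from T-∧ (⇒T-does (q ℕ.≟ q) refl ,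
                 Equivalence.from T-∧ (eqG-refl , subst (T ∘ not) (sym Ij≡) tt)) }) x∈R)

  ofPrime : ℕ → List Trip → List Trip
  ofPrime = fibre (primeOf {n} {m})

  ofPrime-primeOf : ∀ q R → All (λ x → primeOf {n} {m} x ≡ q) (ofPrime q R)
  ofPrime-primeOf q = All.all-filter (λ x → primeOf {n} {m} x ℕ.≟ q)

  inI-ofPrime : ∀ q R j → inI {n} {m} (ofPrime q R) q j ≡ inI {n} {m} R q j
  inI-ofPrime q R j = anyL-filter (λ x → primeOf {n} {m} x ℕ.≟ q) _ R
    (λ x x≢q → cong (_∧ lookup (proj₂ (proj₂ x)) j) (dec-false (primeOf {n} {m} x ℕ.≟ q) x≢q))

  inJ-ofPrime : ∀ q R g j → inJ {n} {m} (ofPrime q R) q g j ≡ inJ {n} {m} R q g j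
  inJ-ofPrime q R g j = anyL-filter (λ x → primeOf {n} {m} x ℕ.≟ q) _ R
    (λ x x≢q → cong (λ b → b ∧ eqG {n} {m} (proj₁ x) g ∧ not (lookup (proj₂ (proj₂ x)) j))
                    (dec-false (primeOf {n} {m} x ℕ.≟ q) x≢q))

  inB-ofPrime : ∀ q R j r → inB (ofPrime q R) q j r ≡ inB R q j r
  inB-ofPrime q R j r = cong or (map-cong (λ g → cong (does (g j ≟ r) ∧_) (inJ-ofPrime q R g j)) (allG n m))

  module _ {P : List ℕ} (uP : Unique P) (pP : All Prime P) {q : ℕ} (q∈P : q ∈ P) where

    𝐚-single : ∀ {R} → All (λ x → primeOf {n} {m} x ≡ q) R →
      ∀ j → 𝐚 P R j ≡ (if inI {n} {m} R q j then q else 1)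
    𝐚-single R≡q j = primeProduct-single uP pP _ q∈P (Occurs-single R≡q ∘ inI⇒Occurs)

    𝐛-single : ∀ {R} → All (λ x → primeOf {n} {m} x ≡ q) R →
      ∀ j r → 𝐛 P R j r ≡ (if inB R q j r then q else 1)
    𝐛-single R≡q j r = primeProduct-single uP pP _ q∈P (Occurs-single R≡q ∘ inB⇒Occurs)

    𝐚-ofPrime : ∀ R j → 𝐚 P (ofPrime q R) j ≡ ppart q (𝐚 P R j)
    𝐚-ofPrime R j = trans (𝐚-single (ofPrime-primeOf q R) j)
      (trans (cong (λ b → if b then q else 1) (inI-ofPrime q R j)) (sym (ppart-primeProduct uP pP _ q∈P)))

    𝐛-ofPrime : ∀ R j r → 𝐛 P (ofPrime q R) j r ≡ ppart q (𝐛 P R j r)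
    𝐛-ofPrime R j r = trans (𝐛-single (ofPrime-primeOf q R) j r)
      (trans (cong (λ b → if b then q else 1) (inB-ofPrime q R j r)) (sym (ppart-primeProduct uP pP _ q∈P)))

  triples : GVec n m → ℕ → List Trip
  triples g p = map (λ I → (g , p , I)) (allSub n)

  triples-prime : ∀ g p → All (λ x → primeOf {n} {m} x ≡ p) (triples g p)
  triples-prime g p = All.map⁺ (All.universal {P = λ I → primeOf {n} {m} (g , p , I) ≡ p} (λ _ → refl) (allSub n))

  triplesAt : ℕ → List Trip
  triplesAt q = concatMap (λ g → triples g q) (allG n m)

  length-triplesAt : ∀ q → length (triplesAt q) ≡ length (allG n m) * length (allSub n)
  length-triplesAt q = go (allG n m)
    where
    go : ∀ gs → length (concatMap (λ g → triples g q) gs) ≡ length gs * length (allSub n)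
    go []       = refl
    go (g ∷ gs) = trans (length-++ (triples g q)) (cong₂ ℕ._+_ (length-map _ (allSub n)) (go gs))

  candidates-∈ : ∀ B → All (λ x → proj₁ x ∈ allG n m × primeOf {n} {m} x ∈ primesUpTo B) (candidates {n} {m} B)
  candidates-∈ B = All.concat⁺ (All.map⁺ (All.tabulate {xs = allG n m} per-g))
    where
    Good : Trip → Set
    Good x = proj₁ x ∈ allG n m × primeOf {n} {m} x ∈ primesUpTo B
    per-g : ∀ {g} → g ∈ allG n m → All Good (concatMap (triples g) (primesUpTo B))
    per-g g∈ = All.concat⁺ (All.map⁺ (All.tabulate {xs = primesUpTo B} λ p∈ →
                 All.map⁺ (All.universal {P = λ I → Good (_ , _ , I)} (λ _ → g∈ , p∈) (allSub n))))

  ofPrime-candidates : ∀ {B q} → q ∈ primesUpTo B → ofPrime q (candidates {n} {m} B) ≡ triplesAt q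
  ofPrime-candidates {B} {q} q∈P = begin
    ofPrime q (concatMap (λ g → concatMap (triples g) P) (allG n m))  ≡⟨ filter-concatMap _ _ (allG n m) ⟩
    concatMap (λ g → ofPrime q (concatMap (triples g) P)) (allG n m)  ≡⟨ concatMap-cong only-q (allG n m) ⟩
    triplesAt q                                                       ∎
    where
    open ≡-Reasoning
    P = primesUpTo B
    only-q : ∀ g → ofPrime q (concatMap (triples g) P) ≡ triples g q
    only-q g = begin
      ofPrime q (concatMap (triples g) P)        ≡⟨ fibre-concatMap (primeOf {n} {m}) (triples g) (triples-prime g) q P ⟩
      concatMap (triples g) (filter (ℕ._≟ q) P)  ≡⟨ cong (concatMap (triples g)) (filter-≟-unique (primesUpTo-unique B) q∈P) ⟩
      triples g q ++ []                          ≡⟨ ++-identityʳ _ ⟩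
      triples g q                                ∎

  ofPrime-candidates-∉ : ∀ {B q} → q ∉ primesUpTo B → ofPrime q (candidates {n} {m} B) ≡ []
  ofPrime-candidates-∉ {B} {q} q∉P = filter-none (λ x → primeOf {n} {m} x ℕ.≟ q)
    (All.map (λ (_ , p∈P) p≡q → q∉P (subst (_∈ primesUpTo B) p≡q p∈P)) (candidates-∈ B))

  𝐚-[] : ∀ P j → 𝐚 P [] j ≡ 1
  𝐚-[] P j = primeProduct-none {P} (λ p → inI {n} {m} [] p j) (λ _ ())

  𝐛-[] : ∀ P j r → 𝐛 P [] j r ≡ 1
  𝐛-[] P j r = primeProduct-none {P} (λ p → inB [] p j r) (λ p → nowhere ∘ inB⇒Occurs {R = []} {p} {j} {r})
    where
    nowhere : ∀ {p} → ¬ Occurs p []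
    nowhere ()

  eqST-[]⇒IsOnes : ∀ {P s t} → T (eqST {n} {m} s t (𝐚 P []) (𝐛 P [])) → IsOnes {n} {m} s t
  eqST-[]⇒IsOnes {P} {s} {t} st with Equivalence.to (eqST⇔ {s} {t}) st
  ... | s≡ , t≡ = (λ j → trans (s≡ j) (𝐚-[] P j)) , (λ j r → trans (t≡ j r) (𝐛-[] P j r))

  IsOnes⇒eqST-[] : ∀ {P s t} → IsOnes {n} {m} s t → T (eqST {n} {m} s t (𝐚 P []) (𝐛 P []))
  IsOnes⇒eqST-[] {P} (s≡1 , t≡1) =
    Equivalence.from eqST⇔ ((λ j → trans (s≡1 j) (sym (𝐚-[] P j))) , (λ j r → trans (t≡1 j r) (sym (𝐛-[] P j r))))

  eqST-cong : ∀ {s t a a′ b b′} → (∀ j → a j ≡ a′ j) → (∀ j r → b j r ≡ b′ j r) →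
    eqST {n} {m} s t a b ≡ eqST {n} {m} s t a′ b′
  eqST-cong {s} {t} {a} {a′} {b} {b′} a≡ b≡ = T-injective
    (λ st → let s≡ , t≡ = Equivalence.to (eqST⇔ {s} {t} {a} {b}) st in
      Equivalence.from eqST⇔ ((λ j → trans (s≡ j) (a≡ j)) , (λ j r → trans (t≡ j r) (b≡ j r))))
    (λ st → let s≡ , t≡ = Equivalence.to (eqST⇔ {s} {t} {a′} {b′}) st in
      Equivalence.from eqST⇔ ((λ j → trans (s≡ j) (sym (a≡ j))) , (λ j r → trans (t≡ j r) (sym (b≡ j r)))))

  ones-unmatched : ∀ {P R s t x} → IsOnes {n} {m} s t → x ∈ R → proj₁ x ∈ allG n m → primeOf {n} {m} x ∈ P →
    Prime (primeOf {n} {m} x) → ¬ SameST s t (𝐚 P R) (𝐛 P R)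
  ones-unmatched {x = g , q , I} (s≡1 , t≡1) x∈R g∈G q∈P pq same with matching⇒∣ same x∈R g∈G q∈P Fin.zero
  ... | inj₁ q∣s = ¬prime[1] (subst Prime (∣1⇒≡1 (subst (q ∣_) (s≡1 Fin.zero) q∣s)) pq)
  ... | inj₂ q∣t = ¬prime[1] (subst Prime (∣1⇒≡1 (subst (q ∣_) (t≡1 Fin.zero (g Fin.zero)) q∣t)) pq)

  sign≡-1^ : ∀ k → sign {n} {m} k ≡ -1ℤ ℤ.^ k
  sign≡-1^ zero    = refl
  sign≡-1^ (suc k) = trans (cong ℤ.-_ (sign≡-1^ k)) (sym (ℤ.-1*i≡-i _))

  ∣sign∣≡1 : ∀ k → ∣ sign {n} {m} k ∣ ≡ 1
  ∣sign∣≡1 zero    = refl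
  ∣sign∣≡1 (suc k) = trans (ℤ.∣-i∣≡∣i∣ (sign {n} {m} k)) (∣sign∣≡1 k)

  primesFor : SVec n → TVec n m → List ℕ
  primesFor s t = primesUpTo (bound {n} {m} s t)

  matches : SVec n → TVec n m → List Trip → Bool
  matches s t R = eqST {n} {m} s t (𝐚 (primesFor s t) R) (𝐛 (primesFor s t) R)

  term : SVec n → TVec n m → List Trip → ℤ
  term s t []        = + 0
  term s t R@(_ ∷ _) = if matches s t R then sign {n} {m} (length R) else + 0

  ∣term∣≤1 : ∀ s t R → ∣ term s t R ∣ ≤ 1
  ∣term∣≤1 s t []        = z≤n
  ∣term∣≤1 s t R@(_ ∷ _) with matches s t R
  ... | true  = ℕ.≤-reflexive (∣sign∣≡1 (length R))
  ... | false = z≤n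

  varpi≡sumSublists : ∀ s t → varpi {n} {m} s t ≡ sumSublists (candidates {n} {m} (bound {n} {m} s t)) (term s t)
  varpi≡sumSublists s t =
    cong sumℤ (map-cong (λ { [] → refl ; (_ ∷ _) → refl }) (sublists (candidates {n} {m} (bound {n} {m} s t))))

  varpi-vanishes : ∀ s t →
    (∀ x R → All (_∈ candidates {n} {m} (bound {n} {m} s t)) (x ∷ R) → ¬ T (matches s t (x ∷ R))) →
    varpi {n} {m} s t ≡ + 0
  varpi-vanishes s t unmatched =
    trans (varpi≡sumSublists s t) (sumSublists-zero (_∈ L) L (All.tabulate id) term≡0)
    where
    L = candidates {n} {m} (bound {n} {m} s t)
    term≡0 : ∀ R → All (_∈ L) R → term s t R ≡ + 0
    term≡0 []        _    = refl
    term≡0 (x ∷ R) R⊆L with matches s t (x ∷ R) in matches≡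
    ... | true  = contradiction (subst T (sym matches≡) tt) (unmatched x R R⊆L)
    ... | false = refl

  term≡if : ∀ {s t} → ¬ IsOnes {n} {m} s t → ∀ R → term s t R ≡ (if matches s t R then -1ℤ ℤ.^ length R else + 0)
  term≡if {s} {t} ¬ones [] with matches s t [] in matches≡
  ... | true  = contradiction (eqST-[]⇒IsOnes {primesFor s t} (subst T (sym matches≡) tt)) ¬ones
  ... | false = refl
  term≡if {s} {t} ¬ones R@(_ ∷ _) with matches s t R
  ... | true  = sign≡-1^ (length R)
  ... | false = refl

  localMatches : SVec n → TVec n m → ℕ → List Trip → Bool
  localMatches s t q R =
    eqST {n} {m} (sLoc {n} {m} q s) (tLoc {n} {m} q t) (𝐚 (primesFor s t) R) (𝐛 (primesFor s t) R)

  localTerm : SVec n → TVec n m → ℕ → List Trip → ℤ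
  localTerm s t q R = if localMatches s t q R then -1ℤ ℤ.^ length R else + 0

  module Positive {s : SVec n} {t : TVec n m} (s≥1 : ∀ j → 1 ≤ s j) (t≥1 : ∀ j r → 1 ≤ t j r) where

    private
      Ps = map s (allFin (suc n))
      Pt : Fin (suc n) → List ℕ
      Pt j = map (t j) (allFin (m j ∸ 1))
      B = bound {n} {m} s t

    instance
      bound≢0 : NonZero B
      bound≢0 = ℕ.m*n≢0 (product Ps) _
        {{product-allFin≢0 s (ℕ.>-nonZero ∘ s≥1)}}
        {{product-allFin≢0 (product ∘ Pt) (λ j → product-allFin≢0 (t j) (ℕ.>-nonZero ∘ t≥1 j))}}

    s∣bound : ∀ j → s j ∣ B
    s∣bound j = ∣-trans (∈⇒∣product (∈-map⁺ s (∈-allFin j))) (m∣m*n _)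

    t∣bound : ∀ j r → t j r ∣ B
    t∣bound j r = ∣-trans (∈⇒∣product (∈-map⁺ (t j) (∈-allFin r)))
                    (∣-trans (∈⇒∣product (∈-map⁺ (product ∘ Pt) (∈-allFin j))) (n∣m*n (product Ps)))

    ∣s⇒∈primesFor : ∀ {r j} → Prime r → r ∣ s j → r ∈ primesFor s t
    ∣s⇒∈primesFor pr r∣s = ∈-primesUpTo pr (∣⇒≤ (∣-trans r∣s (s∣bound _)))

    ∣t⇒∈primesFor : ∀ {r j k} → Prime r → r ∣ t j k → r ∈ primesFor s t
    ∣t⇒∈primesFor pr r∣t = ∈-primesUpTo pr (∣⇒≤ (∣-trans r∣t (t∣bound _ _)))

    private
      P = primesFor s t
      uP = primesUpTo-unique B
      pP = primesUpTo-prime B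

    matches≡and-localMatches : ∀ R → matches s t R ≡ and (map (λ q → localMatches s t q (ofPrime q R)) P)
    matches≡and-localMatches R = T-injective to from
      where
      local-at : ∀ {q} → q ∈ P → SameST s t (𝐚 P R) (𝐛 P R) →
        SameST (sLoc {n} {m} q s) (tLoc {n} {m} q t) (𝐚 P (ofPrime q R)) (𝐛 P (ofPrime q R))
      local-at q∈P (s≡ , t≡) = (λ j → trans (cong (ppart _) (s≡ j)) (sym (𝐚-ofPrime uP pP q∈P R j)))
                             , (λ j r → trans (cong (ppart _) (t≡ j r)) (sym (𝐛-ofPrime uP pP q∈P R j r)))
      to : T (matches s t R) → T (and (map (λ q → localMatches s t q (ofPrime q R)) P))
      to st = All.all⁻ _ (All.tabulate λ q∈P → Equivalence.from eqST⇔ (local-at q∈P (Equivalence.to (eqST⇔ {s} {t}) st)))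
      from : T (and (map (λ q → localMatches s t q (ofPrime q R)) P)) → T (matches s t R)
      from all-local = Equivalence.from eqST⇔
        ( (λ j → ≡primeProduct-byPrimeParts uP pP _ (s≥1 j) ∣s⇒∈primesFor
                   λ q∈P → trans (proj₁ (local q∈P) j) (𝐚-ofPrime uP pP q∈P R j))
        , (λ j r → ≡primeProduct-byPrimeParts uP pP _ (t≥1 j r) ∣t⇒∈primesFor
                   λ q∈P → trans (proj₂ (local q∈P) j r) (𝐛-ofPrime uP pP q∈P R j r)))
        where
        local : ∀ {q} → q ∈ P →
          SameST (sLoc {n} {m} q s) (tLoc {n} {m} q t) (𝐚 P (ofPrime q R)) (𝐛 P (ofPrime q R))
        local q∈P = Equivalence.to eqST⇔ (All.lookup (All.all⁺ _ P all-local) q∈P)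

    -- (s,t) ≠ (1,1) is needed for ℛ = ∅, which contributes 0 to ϖ although it matches (1,1).
    term-factorise : ¬ IsOnes {n} {m} s t → ∀ R → ColouredBy (primeOf {n} {m}) P R →
      term s t R ≡ prodℤ (map (λ q → localTerm s t q (ofPrime q R)) P)
    term-factorise ¬ones R R⊆P = begin
      term s t R
        ≡⟨ term≡if ¬ones R ⟩
      (if matches s t R then -1ℤ ℤ.^ length R else + 0)
        ≡⟨ cong (λ b → if b then _ else + 0) (matches≡and-localMatches R) ⟩
      (if and (map localMatches′ P) then -1ℤ ℤ.^ length R else + 0)
        ≡⟨ cong (λ z → if and (map localMatches′ P) then z else + 0) (-1^length-factorise (primeOf {n} {m}) uP R R⊆P) ⟩
      (if and (map localMatches′ P) then prodℤ (map (λ q → -1ℤ ℤ.^ length (ofPrime q R)) P) else + 0)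
        ≡⟨ prodℤ-if localMatches′ (λ q → -1ℤ ℤ.^ length (ofPrime q R)) P ⟨
      prodℤ (map (λ q → localTerm s t q (ofPrime q R)) P) ∎
      where
      open ≡-Reasoning
      localMatches′ : ℕ → Bool
      localMatches′ q = localMatches s t q (ofPrime q R)

  module Local {q : ℕ} (pq : Prime q) (s : SVec n) (t : TVec n m) where

    s′ : SVec n
    s′ = sLoc {n} {m} q s

    t′ : TVec n m
    t′ = tLoc {n} {m} q t

    private
      P   = primesFor s t
      P′  = primesFor s′ t′
      L   = candidates {n} {m} (bound {n} {m} s t)
      L′  = candidates {n} {m} (bound {n} {m} s′ t′)
      uP  = primesUpTo-unique (bound {n} {m} s t)
      pP  = primesUpTo-prime (bound {n} {m} s t)
      uP′ = primesUpTo-unique (bound {n} {m} s′ t′)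
      pP′ = primesUpTo-prime (bound {n} {m} s′ t′)

    open Positive {s′} {t′} (λ j → 1≤p^e (val q (s j)) (prime⇒2≤ pq)) (λ j r → 1≤p^e (val q (t j r)) (prime⇒2≤ pq))
      using (bound≢0; s∣bound; t∣bound)

    varpi-local≡sumSublists-ofPrime : varpi {n} {m} s′ t′ ≡ sumSublists (ofPrime q L′) (term s′ t′)
    varpi-local≡sumSublists-ofPrime = trans (varpi≡sumSublists s′ t′)
      (sumSublists-filter (_∈ L′) (λ x → primeOf {n} {m} x ℕ.≟ q) L′ (All.tabulate id) only-q)
      where
      -- A triple (g;r;I) of a matching ℛ gives r ∣ s′ 0 or r ∣ t′ 0 (g 0), both powers of q.
      only-q : ∀ R → All (_∈ L′) R → term s′ t′ R ≢ + 0 → All (λ x → primeOf {n} {m} x ≡ q) R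
      only-q []        _    _      = []
      only-q R@(_ ∷ _) R⊆L′ term≢0 with matches s′ t′ R in matches≡
      ... | false = contradiction refl term≢0
      ... | true  = All.tabulate prime≡q
        where
        prime≡q : ∀ {x} → x ∈ R → primeOf {n} {m} x ≡ q
        prime≡q {g , r , I} x∈R with All.lookup (candidates-∈ (bound {n} {m} s′ t′)) (All.lookup R⊆L′ x∈R)
        ... | g∈G , r∈P′ with matching⇒∣ {P′} {R} {s′} {t′} (Equivalence.to eqST⇔ (subst T (sym matches≡) tt)) x∈R g∈G r∈P′ Fin.zero
        ...   | inj₁ r∣s = prime∣p^e⇒≡ (val q (s Fin.zero)) (All.lookup pP′ r∈P′) pq r∣s
        ...   | inj₂ r∣t = prime∣p^e⇒≡ (val q (t Fin.zero (g Fin.zero))) (All.lookup pP′ r∈P′) pq r∣t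

    ¬IsOnes⇒∈primesFor : ¬ IsOnes {n} {m} s′ t′ → q ∈ P′
    ¬IsOnes⇒∈primesFor ¬ones with q ℕ.≤? bound {n} {m} s′ t′
    ... | yes q≤B′ = ∈-primesUpTo pq q≤B′
    ... | no  q≰B′ = contradiction ones ¬ones
      where
      q^v≡1 : ∀ v → q ^ v ∣ bound {n} {m} s′ t′ → q ^ v ≡ 1
      q^v≡1 zero    _       = refl
      q^v≡1 (suc v) q^v∣B′ = contradiction (∣⇒≤ (∣-trans (m∣m*n (q ^ v)) q^v∣B′)) q≰B′
      ones : IsOnes {n} {m} s′ t′
      ones = (λ j → q^v≡1 (val q (s j)) (s∣bound j)) , (λ j r → q^v≡1 (val q (t j r)) (t∣bound j r))

    -- For ℛ of prime q, a(ℛ) and b(ℛ) do not depend on the list of primes as long as it contains q.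
    localTerm≡term : ¬ IsOnes {n} {m} s′ t′ → q ∈ P → q ∈ P′ →
      ∀ R → All (λ x → primeOf {n} {m} x ≡ q) R → localTerm s t q R ≡ term s′ t′ R
    localTerm≡term ¬ones q∈P q∈P′ [] _ with localMatches s t q [] in localMatches≡
    ... | true  = contradiction (eqST-[]⇒IsOnes {P} (subst T (sym localMatches≡) tt)) ¬ones
    ... | false = refl
    localTerm≡term ¬ones q∈P q∈P′ R@(_ ∷ _) R≡q = cong₂ (λ b z → if b then z else + 0)
      (eqST-cong {s′} {t′} (λ j → trans (𝐚-single uP pP q∈P R≡q j) (sym (𝐚-single uP′ pP′ q∈P′ R≡q j)))
                 (λ j r → trans (𝐛-single uP pP q∈P R≡q j r) (sym (𝐛-single uP′ pP′ q∈P′ R≡q j r))))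
      (sym (sign≡-1^ (length R)))

    sumSublists-localTerm : q ∈ P →
      sumSublists (ofPrime q L) (localTerm s t q) ≡ (if isOnesB {n} {m} s′ t′ then + 1 else varpi {n} {m} s′ t′)
    sumSublists-localTerm q∈P with isOnesB {n} {m} s′ t′ in isOnes≡
    ... | true = trans (sumSublists-only[] (_∈ ofPrime q L) (ofPrime q L) (All.tabulate id) unmatched)
                       (cong (λ b → if b then + 1 else + 0) (IsOnes⇒eqST-[]-true))
      where
      ones : IsOnes {n} {m} s′ t′
      ones = Equivalence.to (eqST⇔ {s′} {t′}) (subst T (sym isOnes≡) tt)
      IsOnes⇒eqST-[]-true : localMatches s t q [] ≡ true
      IsOnes⇒eqST-[]-true = Equivalence.to T-≡ (IsOnes⇒eqST-[] {P} ones)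
      unmatched : ∀ x R → All (_∈ ofPrime q L) (x ∷ R) → localTerm s t q (x ∷ R) ≡ + 0
      unmatched x R (x∈ ∷ _) with localMatches s t q (x ∷ R) in localMatches≡
      ... | false = refl
      ... | true with All.lookup (candidates-∈ (bound {n} {m} s t)) (proj₁ (∈-filter⁻ (λ y → primeOf {n} {m} y ℕ.≟ q) x∈))
      ...   | g∈G , r∈P = contradiction (Equivalence.to (eqST⇔ {s′} {t′}) (subst T (sym localMatches≡) tt))
                            (ones-unmatched {P} {x ∷ R} ones (here refl) g∈G r∈P (All.lookup pP r∈P))
    ... | false = begin
      sumSublists (ofPrime q L) (localTerm s t q)  ≡⟨ cong (λ Z → sumSublists Z (localTerm s t q)) L-at-q ⟩
      sumSublists (triplesAt q) (localTerm s t q)  ≡⟨ sumSublists-cong (λ x → primeOf {n} {m} x ≡ q) (triplesAt q)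
                                                        triplesAt-q (localTerm≡term ¬ones q∈P q∈P′) ⟩
      sumSublists (triplesAt q) (term s′ t′)       ≡⟨ cong (λ Z → sumSublists Z (term s′ t′)) L′-at-q ⟨
      sumSublists (ofPrime q L′) (term s′ t′)      ≡⟨ varpi-local≡sumSublists-ofPrime ⟨
      varpi {n} {m} s′ t′                          ∎
      where
      open ≡-Reasoning
      ¬ones : ¬ IsOnes {n} {m} s′ t′
      ¬ones ones = subst T isOnes≡ (Equivalence.from eqST⇔ ones)
      q∈P′ : q ∈ P′
      q∈P′ = ¬IsOnes⇒∈primesFor ¬ones
      L-at-q : ofPrime q L ≡ triplesAt q
      L-at-q = ofPrime-candidates {bound {n} {m} s t} q∈P
      L′-at-q : ofPrime q L′ ≡ triplesAt q
      L′-at-q = ofPrime-candidates {bound {n} {m} s′ t′} q∈P′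
      triplesAt-q : All (λ x → primeOf {n} {m} x ≡ q) (triplesAt q)
      triplesAt-q = subst (All _) L-at-q (ofPrime-primeOf q L)

  module _ (s : SVec n) (t : TVec n m) where

    private
      B = bound {n} {m} s t
      P = primesFor s t
      L = candidates {n} {m} B
      uP = primesUpTo-unique B
      pP = primesUpTo-prime B

      coloured : ∀ {R} → All (_∈ L) R → ColouredBy (primeOf {n} {m}) P R
      coloured = All.map (proj₂ ∘ All.lookup (candidates-∈ B))

    varpi≡localProduct : (∀ j → 1 ≤ s j) → (∀ j r → 1 ≤ t j r) → ¬ IsOnes {n} {m} s t →
      varpi {n} {m} s t ≡ localProduct {n} {m} s t
    varpi≡localProduct s≥1 t≥1 ¬ones = begin
      varpi {n} {m} s t
        ≡⟨ varpi≡sumSublists s t ⟩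
      sumSublists L (term s t)
        ≡⟨ sumSublists-cong (_∈ L) L (All.tabulate id) (λ R R⊆L → term-factorise ¬ones R (coloured R⊆L)) ⟩
      sumSublists L (λ R → prodℤ (map (λ q → localTerm s t q (ofPrime q R)) P))
        ≡⟨ sumSublists-factorise (primeOf {n} {m}) uP L (coloured (All.tabulate id)) (localTerm s t) ⟩
      prodℤ (map (λ q → sumSublists (ofPrime q L) (localTerm s t q)) P)
        ≡⟨ cong prodℤ (map-cong-local (All.tabulate λ q∈P → Local.sumSublists-localTerm (All.lookup pP q∈P) s t q∈P)) ⟩
      localProduct {n} {m} s t ∎
      where
      open ≡-Reasoning
      open Positive s≥1 t≥1 using (term-factorise)

    varpi≡0-ifSquareDivides : ∀ {p} → Prime p → (∃[ j ] (p ^ 2 ∣ s j)) ⊎ (∃[ j ] ∃[ r ] (p ^ 2 ∣ t j r)) →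
      varpi {n} {m} s t ≡ + 0
    varpi≡0-ifSquareDivides {p} pp p²∣ = varpi-vanishes s t λ x R _ st →
      let s≡ , t≡ = Equivalence.to (eqST⇔ {s} {t}) st in case p²∣ of λ where
        (inj₁ (j , p²∣s))     → primeProduct-squarefree uP pP _ pp (subst (p ^ 2 ∣_) (s≡ j) p²∣s)
        (inj₂ (j , r , p²∣t)) → primeProduct-squarefree uP pP _ pp (subst (p ^ 2 ∣_) (t≡ j r) p²∣t)

    varpi≡0-ifCoprimeCoordinate : ∀ {p} → (∀ j → 1 ≤ s j) → (∀ j r → 1 ≤ t j r) → Prime p →
      (∃[ j ] (p ∣ s j)) ⊎ (∃[ j ] ∃[ r ] (p ∣ t j r)) →
      (∃[ j ] ((ppart p (s j) ≡ 1) × (∀ r → ppart p (t j r) ≡ 1))) →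
      varpi {n} {m} s t ≡ + 0
    varpi≡0-ifCoprimeCoordinate {p} s≥1 t≥1 pp p∣ (j₀ , sⱼ₀≡1 , tⱼ₀≡1) = varpi-vanishes s t λ x R R⊆L st →
      let same = Equivalence.to (eqST⇔ {s} {t}) st
          (g , q , I) , y∈R , q≡p = find (occurs same)
          g∈G , q∈P = All.lookup (candidates-∈ B) (All.lookup R⊆L y∈R)
      in case matching⇒∣ {P} {x ∷ R} {s} {t} same y∈R g∈G q∈P j₀ of λ where
        (inj₁ q∣s) → ppart≡1⇒∤ pp (s≥1 j₀) sⱼ₀≡1 (subst (_∣ s j₀) q≡p q∣s)
        (inj₂ q∣t) → ppart≡1⇒∤ pp (t≥1 j₀ (g j₀)) (tⱼ₀≡1 (g j₀)) (subst (_∣ t j₀ (g j₀)) q≡p q∣t)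
      where
      occurs : ∀ {R} → SameST s t (𝐚 P R) (𝐛 P R) → Occurs p R
      occurs (s≡ , t≡) = case p∣ of λ where
        (inj₁ (j , p∣s))     → inI⇒Occurs (proj₂ (prime∣primeProduct⇒ uP pP _ pp (subst (p ∣_) (s≡ j) p∣s)))
        (inj₂ (j , r , p∣t)) → inB⇒Occurs (proj₂ (prime∣primeProduct⇒ uP pP _ pp (subst (p ∣_) (t≡ j r) p∣t)))

  varpiBound : ℕ
  varpiBound = 2 ^ (length (allG n m) * length (allSub n))

  ∣varpi-local∣≤varpiBound : ∀ {p} → Prime p → (s : SVec n) (t : TVec n m) →
    ∣ varpi {n} {m} (sLoc {n} {m} p s) (tLoc {n} {m} p t) ∣ ≤ varpiBound
  ∣varpi-local∣≤varpiBound {p} pp s t = begin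
    ∣ varpi {n} {m} s′ t′ ∣                      ≡⟨ cong ∣_∣ varpi-local≡sumSublists-ofPrime ⟩
    ∣ sumSublists (ofPrime p L′) (term s′ t′) ∣  ≤⟨ ∣sumSublists∣≤2^length (ofPrime p L′) _ (∣term∣≤1 s′ t′) ⟩
    2 ^ length (ofPrime p L′)                    ≤⟨ ℕ.^-monoʳ-≤ 2 length≤ ⟩
    varpiBound                                   ∎
    where
    open ℕ.≤-Reasoning
    open Local pp s t using (s′; t′; varpi-local≡sumSublists-ofPrime)
    L′ = candidates {n} {m} (bound {n} {m} s′ t′)
    length≤ : length (ofPrime p L′) ≤ length (allG n m) * length (allSub n)
    length≤ with p ∈? primesFor s′ t′
    ... | yes p∈P′ =
      ℕ.≤-reflexive (trans (cong length (ofPrime-candidates {bound {n} {m} s′ t′} p∈P′)) (length-triplesAt p))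
    ... | no  p∉P′ = subst (_≤ _) (cong length (sym (ofPrime-candidates-∉ {bound {n} {m} s′ t′} p∉P′))) z≤n

lemma3p2 : (n : ℕ) → 1 ≤ n → (m : Fin (suc n) → ℕ) → (∀ j → 2 ≤ m j) →
  -- (i)
  ((s : SVec n) (t : TVec n m) → (∀ j → 1 ≤ s j) → (∀ j r → 1 ≤ t j r) →
    ¬ IsOnes {n} {m} s t →
    varpi {n} {m} s t ≡ localProduct {n} {m} s t)
  ×
  -- (ii)
  ((s : SVec n) (t : TVec n m) → (∀ j → 1 ≤ s j) → (∀ j r → 1 ≤ t j r) →
    ¬ IsOnes {n} {m} s t → (p : ℕ) → Prime p →
    ((∃[ j ] (p ^ 2 ∣ s j)) ⊎ (∃[ j ] ∃[ r ] (p ^ 2 ∣ t j r))) →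
    varpi {n} {m} s t ≡ + 0)
  ×
  -- (iii)
  ((s : SVec n) (t : TVec n m) → (∀ j → 1 ≤ s j) → (∀ j r → 1 ≤ t j r) →
    ¬ IsOnes {n} {m} s t → (p : ℕ) → Prime p →
    ((∃[ j ] (p ∣ s j)) ⊎ (∃[ j ] ∃[ r ] (p ∣ t j r))) →
    (∃[ j ] ((ppart p (s j) ≡ 1) × (∀ r → ppart p (t j r) ≡ 1))) →
    varpi {n} {m} s t ≡ + 0)
  ×
  -- (iv)
  (∃[ C ] ((s : SVec n) (t : TVec n m) → (∀ j → 1 ≤ s j) → (∀ j r → 1 ≤ t j r) →
    ¬ IsOnes {n} {m} s t → (p : ℕ) → Prime p →
    ∣ varpi {n} {m} (sLoc {n} {m} p s) (tLoc {n} {m} p t) ∣ ≤ C))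
lemma3p2 n _ m _ =
    (λ s t s≥1 t≥1 ¬ones → varpi≡localProduct s t s≥1 t≥1 ¬ones)
  , (λ s t _ _ _ p pp → varpi≡0-ifSquareDivides s t pp)
  , (λ s t s≥1 t≥1 _ p pp → varpi≡0-ifCoprimeCoordinate s t s≥1 t≥1 pp)
  , (varpiBound , λ s t _ _ _ p pp → ∣varpi-local∣≤varpiBound pp s t)
  where open Varpi n m
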